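{- Let $n\ge 2$ and let $p_1,\dots,p_{n-1}\in\{3,6\}$. Let $\Lambda(p_1,\dots,p_{n-1})$ be the quotient of the Coxeter group $[p_1,\dots,p_{n-1}]=\langle \rho_0,\dots,\rho_{n-1}\mid \rho_i^2=1\ (0\le i\le n-1),\ (\rho_{i-1}\rho_i)^{p_i}=1\ (1\le i\le n-1),\ (\rho_i\rho_j)^2=1\ (|i-j|\ge 2)\rangle$ by the relations making each element $(\rho_{i-1}\rho_i)^3$ ($1\le i\le n-1$) central. Then $\Lambda(p_1,\dots,p_{n-1})$, with its generators $\rho_0,\dots,\rho_{n-1}$, is the automorphism group of a regular $n$-polytope of type $\{p_1,\dots,p_{n-1}\}$ with $\frac{p_1\cdots p_{n-1}}{3^{n-1}}(n+1)!$ flags.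
   Context: An (abstract) regular $n$-polytope is one whose automorphism group acts transitively on its flags (maximal chains); its number of flags equals the order of its automorphism group. A string C-group is a group $\Gamma=\langle\rho_0,\dots,\rho_{n-1}\rangle$ with $\rho_i^2=1$, $(\rho_i\rho_j)^2=1$ for $|i-j|\ge2$, and satisfying the intersection condition $\langle\rho_i:i\in I\rangle\cap\langle\rho_i:i\in J\rangle=\langle\rho_i:i\in I\cap J\rangle$ for all $I,J\subseteq\{0,\dots,n-1\}$. Regular $n$-polytopes correspond bijectively to string C-groups (the automorphism group of a regular polytope, with its distinguished generators, is a string C-group, and every string C-group arises this way); the polytope has type $\{p_1,\dots,p_{n-1}\}$ where $p_i$ is the order of $\rho_{i-1}\rho_i$. -}

module Defs where

open import Data.Nat using (ℕ; zero; suc; _+_; _*_; _^_; _≤_; _<_; ∣_-_∣)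

open import Data.Fin using (Fin; toℕ; inject₁)
open import Data.Fin.Subset using (Subset; _∈_; _∩_)
open import Data.List using (List; []; _∷_; _++_; concat; replicate)
open import Data.List.Relation.Unary.All using (All)
open import Data.Product using (Σ; ∃; _×_; _,_)
open import Data.Sum using (_⊎_)
open import Relation.Binary.PropositionalEquality using (_≡_)
open import Relation.Nullary using (¬_)

-- Generators ρ₀,…,ρₘ are indexed by Fin (suc m)  (so n = suc m).
-- Since every generator is an involution, group elements are represented by
-- words in the generators (lists of indices); inverse = reversal.
Word : ℕ → Set
Word n = List (Fin n)

_^ʷ_ : ∀ {n} → Word n → ℕ → Word n
w ^ʷ k = concat (replicate k w)

-- the word ρ_{i-1} ρ_i for i = 1,…,m, indexed by j : Fin m (i = j+1)
adj : ∀ {m} → Fin m → Word (suc m)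
adj j = inject₁ j ∷ Data.Fin.suc j ∷ []

data Rel {m : ℕ} (p : Fin m → ℕ) : Word (suc m) → Word (suc m) → Set where
  invol   : ∀ i → Rel p (i ∷ i ∷ []) []
  braid   : ∀ j → Rel p (adj j ^ʷ p j) []
  commute : ∀ i k → 2 ≤ ∣ toℕ i - toℕ k ∣ → Rel p ((i ∷ k ∷ []) ^ʷ 2) []
  central : ∀ j k → Rel p (k ∷ (adj j ^ʷ 3)) ((adj j ^ʷ 3) ++ (k ∷ []))

-- Equality in the finitely presented group Λ(p): the congruence
-- (equivalence closure of substitution inside words) generated by Rel.
data _≈⟨_⟩_ {m : ℕ} : Word (suc m) → (Fin m → ℕ) → Word (suc m) → Set where
  ≈-step  : ∀ {p} u v {l r} → Rel p l r → (u ++ l ++ v) ≈⟨ p ⟩ (u ++ r ++ v)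
  ≈-refl  : ∀ {p w} → w ≈⟨ p ⟩ w
  ≈-sym   : ∀ {p u v} → u ≈⟨ p ⟩ v → v ≈⟨ p ⟩ u
  ≈-trans : ∀ {p u v w} → u ≈⟨ p ⟩ v → v ≈⟨ p ⟩ w → u ≈⟨ p ⟩ w

module _ {m : ℕ} (p : Fin m → ℕ) where

  InSub : Subset (suc m) → Word (suc m) → Set
  InSub I w = Σ (Word (suc m)) λ u → All (_∈ I) u × (w ≈⟨ p ⟩ u)

  -- intersection condition (the inclusion ⊇ is automatic)
  IntersectionCondition : Set
  IntersectionCondition = ∀ (I J : Subset (suc m)) (w : Word (suc m)) →
    InSub I w → InSub J w → InSub (I ∩ J) w

  HasOrder : Word (suc m) → ℕ → Set
  HasOrder w k = 1 ≤ k × ((w ^ʷ k) ≈⟨ p ⟩ []) ×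
                 (∀ j → 1 ≤ j → j < k → ¬ ((w ^ʷ j) ≈⟨ p ⟩ []))

  HasGroupOrder : ℕ → Set
  HasGroupOrder N = Σ (Fin N → Word (suc m)) λ f →
    (∀ w → ∃ λ i → w ≈⟨ p ⟩ f i) × (∀ i i' → f i ≈⟨ p ⟩ f i' → i ≡ i')

  -- Λ(p) with generators ρ₀..ρₘ is a string C-group (relations ρ_i² = 1 and
  -- (ρ_iρ_j)² = 1 for |i-j| ≥ 2 hold by construction), i.e. the automorphism
  -- group of a regular (m+1)-polytope, of type {p₁,…,pₘ}, with N flags.
  RegularPolytopeGroup : ℕ → Set
  RegularPolytopeGroup N =
    IntersectionCondition × (∀ j → HasOrder (adj j) (p j)) × HasGroupOrder N

{-# OPTIONS --safe #-}
module Submission where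

-- Sending ρᵢ to the transposition (i i+1) maps Λ onto the symmetric group S_{n+1} = [3, …, 3].
-- The kernel is generated by the central involutions z j = (ρⱼ ρⱼ₊₁)³, and z j = 1 when p j = 3.
-- Multiplying on the right by a generator pushes it down the standard coset normal form of
-- S_{n+1} (a product of descending runs ρ_{T-1} ⋯ ρ_a); each braid move
-- ρⱼ₊₁ ρⱼ ρⱼ₊₁ = ρⱼ ρⱼ₊₁ ρⱼ z j leaves a central factor behind. So every element is a normal
-- form times a product of distinct z j with p j = 6. Normal forms are distinct: the permutation
-- action recovers the coset part, and when p j = 6, counting the letters ρᵢ with i ≤ j modulo 2
-- is a homomorphism Λ → ℤ/2 that detects z j alone. Hence |Λ| = 2^#{j | p j = 6} (n+1)!.
-- Normalisation never introduces a generator missing from its input; with uniqueness of normal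
-- forms this gives the intersection condition. The orders of ρⱼ ρⱼ₊₁ can be read off the same
-- two representations.

-- renamed so that the setoid-reasoning syntax _≈⟨_⟩_ is unambiguous
open import Defs hiding (_≈⟨_⟩_)
open Defs using () renaming (_≈⟨_⟩_ to _≈[_]_)

open import Data.Bool using (Bool; true; false; not; _xor_; T)
open import Data.Bool.Properties using (xor-assoc; xor-comm; xor-same; xor-identityʳ; not-involutive; T-≡)
open import Data.Empty using (⊥-elim)
open import Data.Fin using (Fin; toℕ; inject₁; fromℕ<)
import Data.Fin as F
open import Data.Fin.Properties using (toℕ-inject₁; toℕ<n; toℕ-fromℕ<; fromℕ<-toℕ; 1↔⊤; 2↔Bool; *↔×)
open import Data.Fin.Subset using (_∈_)
open import Data.Fin.Subset.Properties using (x∈p∩q⁺)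
open import Data.List using (List; []; _∷_; _++_; length; foldl; replicate; tabulate; upTo)
open import Data.List.Properties
  using (++-assoc; ++-identityʳ; ++-cancelˡ; ++-cancelʳ; ∷-injectiveˡ; ∷-injectiveʳ; foldl-++;
         length-++; length-replicate; length-upTo; upTo-∷ʳ)
open import Data.List.Relation.Unary.All as All using (All; []; _∷_)
import Data.List.Relation.Unary.All.Properties as All
open import Data.Nat using (ℕ; zero; suc; _+_; _*_; _∸_; _^_; _≤_; _<_; z≤n; s≤s; ∣_-_∣; _≡ᵇ_; _≤ᵇ_; _!)
open import Data.Nat.ListAction using (product)
open import Data.Nat.Properties
open import Algebra.Properties.CommutativeSemigroup *-commutativeSemigroup using (interchange)
open import Data.Product using (Σ; ∃; _×_; _,_; proj₁; proj₂)
open import Data.Product.Function.NonDependent.Propositional using (_×-↔_)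
open import Data.Sum using (_⊎_; inj₁; inj₂)
open import Data.Unit using (⊤; tt)
open import Function.Base using (_∘_; id; case_of_)
open import Function.Bundles using (_↔_; Inverse; Equivalence; mk↔ₛ′)
open import Function.Properties.Inverse using (↔-trans)
open import Relation.Binary.Bundles using (Setoid)
open import Relation.Binary.Definitions using (tri<; tri≈; tri>)
open import Relation.Binary.PropositionalEquality as ≡ using (_≡_; _≢_; refl; cong; cong₂; sym; subst)
import Relation.Binary.Reasoning.Setoid as SetoidReasoning
open import Relation.Nullary using (¬_)

clamp : (n : ℕ) → ℕ → Fin (suc n)
clamp n       zero    = F.zero
clamp zero    (suc k) = F.zero
clamp (suc n) (suc k) = F.suc (clamp n k)

toℕ-clamp : ∀ {n k} → k ≤ n → toℕ (clamp n k) ≡ k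
toℕ-clamp {k = zero}  _         = refl
toℕ-clamp {k = suc k} (s≤s k≤n) = cong suc (toℕ-clamp k≤n)

clamp-toℕ : ∀ {n} (i : Fin (suc n)) → clamp n (toℕ i) ≡ i
clamp-toℕ         F.zero    = refl
clamp-toℕ {suc n} (F.suc i) = cong F.suc (clamp-toℕ i)

inject₁-clamp : ∀ {n k} → k ≤ n → inject₁ (clamp n k) ≡ clamp (suc n) k
inject₁-clamp {k = zero}  _         = refl
inject₁-clamp {k = suc k} (s≤s k≤n) = cong F.suc (inject₁-clamp k≤n)

≤ᵇ-true : ∀ {i j} → i ≤ j → (i ≤ᵇ j) ≡ true
≤ᵇ-true i≤j = Equivalence.to T-≡ (≤⇒≤ᵇ i≤j)

≤ᵇ-false : ∀ {i j} → ¬ i ≤ j → (i ≤ᵇ j) ≡ false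
≤ᵇ-false {i} {j} i≰j with i ≤ᵇ j in eq
... | true  = ⊥-elim (i≰j (≤ᵇ⇒≤ i j (subst T (sym eq) tt)))
... | false = refl

≤ᵇ-step : ∀ i j → i ≢ j → (i ≤ᵇ j) ≡ (suc i ≤ᵇ j)
≤ᵇ-step i j i≢j with <-cmp i j
... | tri< i<j _   _   = ≡.trans (≤ᵇ-true (<⇒≤ i<j)) (sym (≤ᵇ-true i<j))
... | tri≈ _   i≡j _   = ⊥-elim (i≢j i≡j)
... | tri> _   _   j<i = ≡.trans (≤ᵇ-false (<⇒≱ j<i)) (sym (≤ᵇ-false (<⇒≱ j<i ∘ <⇒≤)))

gap≥2 : ∀ {i y} → 2 + i ≤ y → 2 ≤ ∣ i - y ∣
gap≥2 {zero}          le        = le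
gap≥2 {suc i} {suc y} (s≤s le)  = gap≥2 {i} le

gap≥2′ : ∀ {i y} → 2 + y ≤ i → 2 ≤ ∣ i - y ∣
gap≥2′ {i} {y} le = subst (2 ≤_) (∣-∣-comm y i) (gap≥2 le)

xor-cancelʳ : ∀ b c → (b xor c) xor c ≡ b
xor-cancelʳ b c = ≡.trans (xor-assoc b c c) (≡.trans (cong (b xor_) (xor-same c)) (xor-identityʳ b))

xor-cancelˡ : ∀ c b b′ → c xor b ≡ c xor b′ → b ≡ b′
xor-cancelˡ false b b′ eq = eq
xor-cancelˡ true  b b′ eq = ≡.trans (sym (not-involutive b)) (≡.trans (cong not eq) (not-involutive b′))

xor-swap : ∀ b c d → (b xor c) xor d ≡ (b xor d) xor c
xor-swap b c d = ≡.trans (xor-assoc b c d) (≡.trans (cong (b xor_) (xor-comm c d)) (sym (xor-assoc b d c)))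

Bit : Bool → Set
Bit true  = Bool
Bit false = ⊤

toggleBit : ∀ {s} → Bit s → Bit s
toggleBit {true}  b = not b
toggleBit {false} b = b

bitOff : ∀ s → Bit s
bitOff true  = false
bitOff false = tt

bitWord : ∀ {A : Set} {s} → Bit s → List A → List A
bitWord {s = true}  true  w = w
bitWord {s = true}  false w = []
bitWord {s = false} tt    w = []

bitValue : ∀ {s} → Bit s → Bool
bitValue {true}  b = b
bitValue {false} _ = false

bit-injective : ∀ {s} (b b′ : Bit s) → (s ≡ true → bitValue b ≡ bitValue b′) → b ≡ b′
bit-injective {true}  b  b′ same = same refl
bit-injective {false} tt tt _    = refl

bitCount : Bool → ℕ
bitCount true  = 2
bitCount false = 1

Fin↔Bit : ∀ s → Fin (bitCount s) ↔ Bit s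
Fin↔Bit true  = 2↔Bool
Fin↔Bit false = 1↔⊤

bitWord-support : ∀ {A : Set} {P : A → Set} {s} (b : Bit s) {w} → All P w → All P (bitWord b w)
bitWord-support {s = true}  true  all = all
bitWord-support {s = true}  false _   = []
bitWord-support {s = false} tt    _   = []

z : ∀ {m} → Fin m → Word (suc m)
z j = adj j ^ʷ 3

module _ {m : ℕ} {p : Fin m → ℕ} {X : Set} (act : X → Fin (suc m) → X) (Good : X → Set)
         (act-good : ∀ x i → Good x → Good (act x i)) where

  foldl-good : ∀ x w → Good x → Good (foldl act x w)
  foldl-good x []      good = good
  foldl-good x (i ∷ w) good = foldl-good (act x i) w (act-good x i good)

  action-respects-≈ : (∀ {l r} → Rel p l r → ∀ x → Good x → foldl act x l ≡ foldl act x r) →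
                      ∀ {u v} → u ≈[ p ] v → ∀ x → Good x → foldl act x u ≡ foldl act x v
  action-respects-≈ respects (≈-step u v {l} {r} l~r) x good = begin
    foldl act x (u ++ l ++ v)                 ≡⟨ split l ⟩
    foldl act (foldl act (foldl act x u) l) v ≡⟨ cong (λ y → foldl act y v) (respects l~r _ (foldl-good x u good)) ⟩
    foldl act (foldl act (foldl act x u) r) v ≡⟨ split r ⟨
    foldl act x (u ++ r ++ v)                 ∎
    where
    open ≡.≡-Reasoning
    split : ∀ w → foldl act x (u ++ w ++ v) ≡ foldl act (foldl act (foldl act x u) w) v
    split w = ≡.trans (foldl-++ act x u (w ++ v)) (foldl-++ act (foldl act x u) w v)
  action-respects-≈ respects ≈-refl              x good = refl
  action-respects-≈ respects (≈-sym u≈v)         x good = sym (action-respects-≈ respects u≈v x good)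
  action-respects-≈ respects (≈-trans u≈v v≈w)   x good =
    ≡.trans (action-respects-≈ respects u≈v x good) (action-respects-≈ respects v≈w x good)

module Presentation {m : ℕ} (p : Fin m → ℕ) where

  infix 4 _≈_
  _≈_ : Word (suc m) → Word (suc m) → Set
  u ≈ v = u ≈[ p ] v

  ≈-setoid : Setoid _ _
  ≈-setoid = record
    { Carrier       = Word (suc m)
    ; _≈_           = _≈_
    ; isEquivalence = record { refl = ≈-refl ; sym = ≈-sym ; trans = ≈-trans }
    }

  open Setoid ≈-setoid public using () renaming (reflexive to ≈-reflexive)
  module ≈-Reasoning = SetoidReasoning ≈-setoid
  open ≈-Reasoning

  ≈-inContext : ∀ a b {u v} → u ≈ v → a ++ u ++ b ≈ a ++ v ++ b
  ≈-inContext a b (≈-step u v {l} {r} l~r) = begin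
    a ++ (u ++ l ++ v) ++ b   ≡⟨ regroup l ⟩
    (a ++ u) ++ l ++ (v ++ b) ≈⟨ ≈-step (a ++ u) (v ++ b) l~r ⟩
    (a ++ u) ++ r ++ (v ++ b) ≡⟨ regroup r ⟨
    a ++ (u ++ r ++ v) ++ b   ∎
    where
    regroup : ∀ x → a ++ (u ++ x ++ v) ++ b ≡ (a ++ u) ++ x ++ (v ++ b)
    regroup x = ≡.trans (cong (a ++_) (≡.trans (++-assoc u (x ++ v) b) (cong (u ++_) (++-assoc x v b))))
                        (sym (++-assoc a u (x ++ v ++ b)))
  ≈-inContext a b ≈-refl          = ≈-refl
  ≈-inContext a b (≈-sym u≈v)     = ≈-sym (≈-inContext a b u≈v)
  ≈-inContext a b (≈-trans u≈v v≈w) = ≈-trans (≈-inContext a b u≈v) (≈-inContext a b v≈w)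

  ++-congʳ : ∀ w {u v} → u ≈ v → u ++ w ≈ v ++ w
  ++-congʳ w = ≈-inContext [] w

  ++-congˡ : ∀ w {u v} → u ≈ v → w ++ u ≈ w ++ v
  ++-congˡ w {u} {v} u≈v = begin
    w ++ u        ≡⟨ cong (w ++_) (++-identityʳ u) ⟨
    w ++ u ++ []  ≈⟨ ≈-inContext w [] u≈v ⟩
    w ++ v ++ []  ≡⟨ cong (w ++_) (++-identityʳ v) ⟩
    w ++ v        ∎

  relation⇒≈ : ∀ {l r} → Rel p l r → l ≈ r
  relation⇒≈ {l} {r} l~r = begin
    l             ≡⟨ ++-identityʳ l ⟨
    [] ++ l ++ [] ≈⟨ ≈-step [] [] l~r ⟩
    [] ++ r ++ [] ≡⟨ ++-identityʳ r ⟩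
    r             ∎

  involution : ∀ i → i ∷ i ∷ [] ≈ []
  involution i = relation⇒≈ (invol i)

  Far : Fin (suc m) → Fin (suc m) → Set
  Far i k = 2 ≤ ∣ toℕ i - toℕ k ∣

  far-comm : ∀ {i k} → Far i k → i ∷ k ∷ [] ≈ k ∷ i ∷ []
  far-comm {i} {k} far = begin
    i ∷ k ∷ []                         ≈⟨ ++-congˡ (i ∷ k ∷ []) (relation⇒≈ (commute k i far′)) ⟨
    i ∷ k ∷ k ∷ i ∷ k ∷ i ∷ []         ≈⟨ ≈-inContext (i ∷ []) (i ∷ k ∷ i ∷ []) (involution k) ⟩
    i ∷ i ∷ k ∷ i ∷ []                 ≈⟨ ++-congʳ (k ∷ i ∷ []) (involution i) ⟩
    k ∷ i ∷ []                         ∎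
    where far′ = subst (2 ≤_) (∣-∣-comm (toℕ i) (toℕ k)) far

  far-comm-word : ∀ {i} w → All (Far i) w → w ++ i ∷ [] ≈ i ∷ w
  far-comm-word     []      []           = ≈-refl
  far-comm-word {i} (k ∷ w) (far ∷ fars) = begin
    k ∷ w ++ i ∷ [] ≈⟨ ++-congˡ (k ∷ []) (far-comm-word w fars) ⟩
    k ∷ i ∷ w       ≈⟨ ++-congʳ w (far-comm far) ⟨
    i ∷ k ∷ w       ∎

  Central : Word (suc m) → Set
  Central c = ∀ w → w ++ c ≈ c ++ w

  []-central : Central []
  []-central w = ≈-reflexive (++-identityʳ w)

  ++-central : ∀ {c c′} → Central c → Central c′ → Central (c ++ c′)
  ++-central {c} {c′} c-central c′-central w = begin
    w ++ c ++ c′   ≡⟨ ++-assoc w c c′ ⟨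
    (w ++ c) ++ c′ ≈⟨ ++-congʳ c′ (c-central w) ⟩
    (c ++ w) ++ c′ ≡⟨ ++-assoc c w c′ ⟩
    c ++ w ++ c′   ≈⟨ ++-congˡ c (c′-central w) ⟩
    c ++ c′ ++ w   ≡⟨ ++-assoc c c′ w ⟨
    (c ++ c′) ++ w ∎

  z-central : ∀ j → Central (z j)
  z-central j []      = ≈-sym ([]-central (z j))
  z-central j (k ∷ w) = begin
    k ∷ w ++ z j         ≈⟨ ++-congˡ (k ∷ []) (z-central j w) ⟩
    k ∷ z j ++ w         ≈⟨ ++-congʳ w (relation⇒≈ (central j k)) ⟩
    (z j ++ k ∷ []) ++ w ≡⟨ ++-assoc (z j) (k ∷ []) w ⟩
    z j ++ k ∷ w         ∎

  braid-z : ∀ j → F.suc j ∷ inject₁ j ∷ F.suc j ∷ [] ≈ inject₁ j ∷ F.suc j ∷ inject₁ j ∷ z j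
  braid-z j = ≈-sym (begin
    x ∷ y ∷ x ∷ x ∷ y ∷ x ∷ y ∷ x ∷ y ∷ [] ≈⟨ ≈-inContext (x ∷ y ∷ []) (y ∷ x ∷ y ∷ x ∷ y ∷ []) (involution x) ⟩
    x ∷ y ∷ y ∷ x ∷ y ∷ x ∷ y ∷ []         ≈⟨ ≈-inContext (x ∷ []) (x ∷ y ∷ x ∷ y ∷ []) (involution y) ⟩
    x ∷ x ∷ y ∷ x ∷ y ∷ []                 ≈⟨ ++-congʳ (y ∷ x ∷ y ∷ []) (involution x) ⟩
    y ∷ x ∷ y ∷ []                         ∎)
    where
    x = inject₁ j
    y = F.suc j

  bitWord-toggle : ∀ {s} (b : Bit s) {c} → (s ≡ false → c ≈ []) → c ++ c ≈ [] →
                   c ++ bitWord b c ≈ bitWord (toggleBit b) c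
  bitWord-toggle {true}  true      _    c²≈[] = c²≈[]
  bitWord-toggle {true}  false {c} _    _     = ≈-reflexive (++-identityʳ c)
  bitWord-toggle {false} tt    {c} c≈[] _     = ≈-trans (≈-reflexive (++-identityʳ c)) (c≈[] refl)

  bitWord-central : ∀ {s} (b : Bit s) {c} → Central c → Central (bitWord b c)
  bitWord-central {true}  true  c-central = c-central
  bitWord-central {true}  false _         = []-central
  bitWord-central {false} tt    _         = []-central

  central-swap : ∀ C D {Z} → Central Z → (C ++ Z) ++ D ≈ (C ++ D) ++ Z
  central-swap C D {Z} Z-central = begin
    (C ++ Z) ++ D ≡⟨ ++-assoc C Z D ⟩
    C ++ Z ++ D   ≈⟨ ++-congˡ C (Z-central D) ⟨
    C ++ D ++ Z   ≡⟨ ++-assoc C D Z ⟨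
    (C ++ D) ++ Z ∎

  replace-last : ∀ C D {D′ Z x} → Central Z → D ++ x ∷ [] ≈ D′ → ((C ++ D) ++ Z) ++ x ∷ [] ≈ (C ++ D′) ++ Z
  replace-last C D {D′} {Z} {x} Z-central Dx≈D′ = begin
    ((C ++ D) ++ Z) ++ x ∷ [] ≈⟨ central-swap (C ++ D) (x ∷ []) Z-central ⟩
    ((C ++ D) ++ x ∷ []) ++ Z ≡⟨ cong (_++ Z) (++-assoc C D (x ∷ [])) ⟩
    (C ++ D ++ x ∷ []) ++ Z   ≈⟨ ++-congʳ Z (++-congˡ C Dx≈D′) ⟩
    (C ++ D′) ++ Z            ∎

  pass-through : ∀ C D {Z Z′ c x x′} → Central Z → Central Z′ → D ++ x ∷ [] ≈ x′ ∷ D ++ c → c ++ Z ≈ Z′ →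
                 ((C ++ D) ++ Z) ++ x ∷ [] ≈ ((C ++ Z′) ++ x′ ∷ []) ++ D
  pass-through C D {Z} {Z′} {c} {x} {x′} Z-central Z′-central Dx≈x′Dc cZ≈Z′ = begin
    ((C ++ D) ++ Z) ++ x ∷ []   ≈⟨ replace-last C D Z-central Dx≈x′Dc ⟩
    (C ++ x′ ∷ D ++ c) ++ Z     ≡⟨ ++-assoc C (x′ ∷ D ++ c) Z ⟩
    C ++ x′ ∷ (D ++ c) ++ Z     ≡⟨ cong (λ w → C ++ x′ ∷ w) (++-assoc D c Z) ⟩
    C ++ x′ ∷ D ++ c ++ Z       ≈⟨ ++-congˡ C (++-congˡ (x′ ∷ D) cZ≈Z′) ⟩
    C ++ x′ ∷ D ++ Z′           ≈⟨ ++-congˡ C (++-congˡ (x′ ∷ []) (Z′-central D)) ⟩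
    C ++ (x′ ∷ []) ++ Z′ ++ D   ≡⟨ cong (C ++_) (++-assoc (x′ ∷ []) Z′ D) ⟨
    C ++ (x′ ∷ Z′) ++ D         ≈⟨ ++-congˡ C (++-congʳ D (Z′-central (x′ ∷ []))) ⟩
    C ++ (Z′ ++ x′ ∷ []) ++ D   ≡⟨ ++-assoc C (Z′ ++ x′ ∷ []) D ⟨
    (C ++ Z′ ++ x′ ∷ []) ++ D   ≡⟨ cong (_++ D) (++-assoc C Z′ (x′ ∷ [])) ⟨
    ((C ++ Z′) ++ x′ ∷ []) ++ D ∎

  hasGroupOrder : ∀ {N} {A : Set} (e : Fin N ↔ A) (⟦_⟧ : A → Word (suc m)) →
                  (∀ w → ∃ λ x → w ≈ ⟦ x ⟧) → (∀ x y → ⟦ x ⟧ ≈ ⟦ y ⟧ → x ≡ y) → HasGroupOrder p N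
  hasGroupOrder e ⟦_⟧ normalise ⟦⟧-injective = ⟦_⟧ ∘ to , surjective , injective
    where
    open Inverse e
    surjective : ∀ w → ∃ λ i → w ≈ ⟦ to i ⟧
    surjective w = from x , ≈-trans w≈x (≈-reflexive (cong ⟦_⟧ (sym (strictlyInverseˡ x))))
      where
      x = proj₁ (normalise w)
      w≈x = proj₂ (normalise w)
    injective : ∀ i i′ → ⟦ to i ⟧ ≈ ⟦ to i′ ⟧ → i ≡ i′
    injective i i′ eq =
      ≡.trans (sym (strictlyInverseʳ i)) (≡.trans (cong from (⟦⟧-injective _ _ eq)) (strictlyInverseʳ i′))

-- The permutation and parity representations

swap : {A : Set} → ℕ → List A → List A
swap zero    []          = []
swap zero    (x ∷ [])    = x ∷ []
swap zero    (x ∷ y ∷ t) = y ∷ x ∷ t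
swap (suc k) []          = []
swap (suc k) (x ∷ t)     = x ∷ swap k t

swapAt : ∀ {A : Set} {n} → List A → Fin n → List A
swapAt s i = swap (toℕ i) s

permute : ∀ {A : Set} {n} → List A → Word n → List A
permute = foldl swapAt

length-swap : ∀ {A : Set} k (s : List A) → length (swap k s) ≡ length s
length-swap zero    []          = refl
length-swap zero    (x ∷ [])    = refl
length-swap zero    (x ∷ y ∷ t) = refl
length-swap (suc k) []          = refl
length-swap (suc k) (x ∷ t)     = cong suc (length-swap k t)

swap-involutive : ∀ {A : Set} k (s : List A) → swap k (swap k s) ≡ s
swap-involutive zero    []          = refl
swap-involutive zero    (x ∷ [])    = refl
swap-involutive zero    (x ∷ y ∷ t) = refl
swap-involutive (suc k) []          = refl
swap-involutive (suc k) (x ∷ t)     = cong (x ∷_) (swap-involutive k t)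

swap-comm : ∀ {A : Set} a b (s : List A) → 2 ≤ ∣ a - b ∣ → swap a (swap b s) ≡ swap b (swap a s)
swap-comm zero          (suc (suc b)) []          _ = refl
swap-comm zero          (suc (suc b)) (x ∷ [])    _ = refl
swap-comm zero          (suc (suc b)) (x ∷ y ∷ t) _ = refl
swap-comm (suc (suc a)) zero          []          _ = refl
swap-comm (suc (suc a)) zero          (x ∷ [])    _ = refl
swap-comm (suc (suc a)) zero          (x ∷ y ∷ t) _ = refl
swap-comm (suc a)       (suc b)       []          _ = refl
swap-comm (suc a)       (suc b)       (x ∷ t)     far = cong (x ∷_) (swap-comm a b t far)
swap-comm zero          zero          _ ()
swap-comm zero          (suc zero)    _ (s≤s ())
swap-comm (suc zero)    zero          _ (s≤s ())

z-fixes : ∀ {A : Set} {n} (j : Fin n) (s : List A) → 2 + toℕ j < length s → permute s (z j) ≡ s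
z-fixes F.zero    (x ∷ y ∷ w ∷ t) _         = refl
z-fixes F.zero    (x ∷ [])        (s≤s ())
z-fixes F.zero    (x ∷ y ∷ [])    (s≤s (s≤s ()))
z-fixes (F.suc j) (x ∷ t)         (s≤s len) = cong (x ∷_) (z-fixes j t len)

adj-rotates : ∀ {A : Set} {n} (j : Fin n) xs (a b c : A) ys → length xs ≡ toℕ j →
              permute (xs ++ a ∷ b ∷ c ∷ ys) (adj j) ≡ xs ++ b ∷ c ∷ a ∷ ys
adj-rotates F.zero    []       a b c ys _   = refl
adj-rotates (F.suc j) (x ∷ xs) a b c ys len = cong (x ∷_) (adj-rotates j xs a b c ys (suc-injective len))

spin : {A : Set} → ℕ → A → A → A → List A
spin zero    a b c = a ∷ b ∷ c ∷ []
spin (suc k) a b c = spin k b c a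

adj-power-spins : ∀ {A : Set} {n} (j : Fin n) xs (a b c : A) ys k → length xs ≡ toℕ j →
                  permute (xs ++ a ∷ b ∷ c ∷ ys) (adj j ^ʷ k) ≡ xs ++ spin k a b c ++ ys
adj-power-spins j xs a b c ys zero    _   = refl
adj-power-spins j xs a b c ys (suc k) len =
  ≡.trans (cong (λ s → permute s (adj j ^ʷ k)) (adj-rotates j xs a b c ys len)) (adj-power-spins j xs b c a ys k len)

length-permute : ∀ {A : Set} {n} (s : List A) (w : Word n) → length (permute s w) ≡ length s
length-permute s []      = refl
length-permute s (i ∷ w) = ≡.trans (length-permute (swap (toℕ i) s) w) (length-swap (toℕ i) s)

swap-All : ∀ {A : Set} {P : A → Set} k {s} → All P s → All P (swap k s)
swap-All zero    {[]}        all               = all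
swap-All zero    {x ∷ []}    all               = all
swap-All zero    {x ∷ y ∷ t} (Px ∷ Py ∷ all)   = Py ∷ Px ∷ all
swap-All (suc k) {[]}        all               = all
swap-All (suc k) {x ∷ t}     (Px ∷ all)        = Px ∷ swap-All k all

permute-All : ∀ {A : Set} {P : A → Set} {n} {s} (w : Word n) → All P s → All P (permute s w)
permute-All []      all = all
permute-All (i ∷ w) all = permute-All w (swap-All (toℕ i) all)

swap-++ : ∀ {A : Set} k (xs ys : List A) → suc k < length xs → swap k (xs ++ ys) ≡ swap k xs ++ ys
swap-++ zero    (x ∷ y ∷ t) ys _        = refl
swap-++ zero    (x ∷ [])    ys (s≤s ())
swap-++ (suc k) (x ∷ t)     ys (s≤s lt) = cong (x ∷_) (swap-++ k t ys lt)

permute-++ : ∀ {A : Set} {n} (w : Word n) (xs ys : List A) → All (λ i → suc (toℕ i) < length xs) w →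
             permute (xs ++ ys) w ≡ permute xs w ++ ys
permute-++ []      xs ys []           = refl
permute-++ (i ∷ w) xs ys (lt ∷ all) =
  ≡.trans (cong (λ s → permute s w) (swap-++ (toℕ i) xs ys lt))
          (permute-++ w (swap (toℕ i) xs) ys
                      (subst (λ l → All (λ i → suc (toℕ i) < l) w) (sym (length-swap (toℕ i) xs)) all))

insertAt : {A : Set} → ℕ → A → List A → List A
insertAt zero    x ys       = x ∷ ys
insertAt (suc a) x []       = x ∷ []
insertAt (suc a) x (y ∷ ys) = y ∷ insertAt a x ys

insertAt-last : ∀ {A : Set} (x : A) xs → insertAt (length xs) x xs ≡ xs ++ x ∷ []
insertAt-last x []       = refl
insertAt-last x (y ∷ xs) = cong (y ∷_) (insertAt-last x xs)

swap-insertAt : ∀ {A : Set} a (x : A) xs ys → a < length xs →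
                swap a (insertAt (suc a) x xs ++ ys) ≡ insertAt a x xs ++ ys
swap-insertAt zero    x (y ∷ xs) ys _        = refl
swap-insertAt (suc a) x (y ∷ xs) ys (s≤s lt) = cong (y ∷_) (swap-insertAt a x xs ys lt)

insertAt-injective : ∀ {x} a a′ xs xs′ → All (_< x) xs → All (_< x) xs′ → a ≤ length xs → a′ ≤ length xs′ →
                     insertAt a x xs ≡ insertAt a′ x xs′ → a ≡ a′ × xs ≡ xs′
insertAt-injective zero    zero     _        _         _         _         _        _         eq =
  refl , ∷-injectiveʳ eq
insertAt-injective zero    (suc a′) _        (y ∷ xs′) _         (y<x ∷ _) _        _         eq =
  ⊥-elim (<-irrefl (sym (∷-injectiveˡ eq)) y<x)
insertAt-injective (suc a) zero     (y ∷ xs) _         (y<x ∷ _) _         _        _         eq =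
  ⊥-elim (<-irrefl (∷-injectiveˡ eq) y<x)
insertAt-injective (suc a) (suc a′) (y ∷ xs) (_ ∷ xs′) (_ ∷ all) (_ ∷ all′) (s≤s le) (s≤s le′) eq
  with insertAt-injective a a′ xs xs′ all all′ le le′ (∷-injectiveʳ eq)
... | refl , refl = refl , cong (_∷ xs) (∷-injectiveˡ eq)

alternate : ℕ → Bool → Bool → Bool → Bool
alternate zero    b c d = b
alternate (suc k) b c d = alternate k ((b xor c) xor d) c d

alternate-same : ∀ k b c → alternate k b c c ≡ b
alternate-same zero    b c = refl
alternate-same (suc k) b c = ≡.trans (cong (λ x → alternate k x c c) (xor-cancelʳ b c)) (alternate-same k b c)

alternate-2 : ∀ b c d → alternate 2 b c d ≡ b
alternate-2 b c d = begin
  (((b xor c) xor d) xor c) xor d ≡⟨ cong (_xor d) (xor-swap (b xor c) d c) ⟩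
  (((b xor c) xor c) xor d) xor d ≡⟨ xor-cancelʳ _ d ⟩
  (b xor c) xor c                 ≡⟨ xor-cancelʳ b c ⟩
  b                               ∎
  where open ≡.≡-Reasoning

alternate-6 : ∀ b c d → alternate 6 b c d ≡ b
alternate-6 b c d = ≡.trans (cong (λ x → alternate 4 x c d) (alternate-2 b c d))
                            (≡.trans (cong (λ x → alternate 2 x c d) (alternate-2 b c d)) (alternate-2 b c d))

alternate-3 : ∀ b → alternate 3 b true false ≡ not b
alternate-3 false = refl
alternate-3 true  = refl

alternate-xor : ∀ k b c d e → alternate k (b xor e) c d ≡ alternate k b c d xor e
alternate-xor zero    b c d e = refl
alternate-xor (suc k) b c d e =
  ≡.trans (cong (λ x → alternate k x c d) regroup) (alternate-xor k ((b xor c) xor d) c d e)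
  where
  regroup : ((b xor e) xor c) xor d ≡ ((b xor c) xor d) xor e
  regroup = ≡.trans (cong (_xor d) (xor-swap b e c)) (xor-swap (b xor c) e d)

flipBelow : ∀ {n} → ℕ → Bool → Fin n → Bool
flipBelow j b i = b xor (toℕ i ≤ᵇ j)

parity : ∀ {n} → ℕ → Bool → Word n → Bool
parity j = foldl (flipBelow j)

parity-++ : ∀ {n} j b (u v : Word n) → parity j b (u ++ v) ≡ parity j (parity j b u) v
parity-++ j = foldl-++ (flipBelow j)

parity-adj : ∀ {n} j (i : Fin n) b k →
             parity j b (adj i ^ʷ k) ≡ alternate k b (toℕ (inject₁ i) ≤ᵇ j) (suc (toℕ i) ≤ᵇ j)
parity-adj j i b zero    = refl
parity-adj j i b (suc k) = parity-adj j i _ k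

module Construction (m : ℕ) (p : Fin (suc m) → ℕ) (hp : ∀ j → p j ≡ 3 ⊎ p j ≡ 6) where
  open Presentation p

  L : ℕ
  L = suc (suc m)

  letter : ℕ → Fin L
  letter = clamp (suc m)

  zAt : ℕ → Word L
  zAt k = z (clamp m k)

  six : ℕ → Bool
  six k = p (clamp m k) ≡ᵇ 6

  six-toℕ : ∀ j → six (toℕ j) ≡ (p j ≡ᵇ 6)
  six-toℕ j = cong (λ i → p i ≡ᵇ 6) (clamp-toℕ j)

  z-square : ∀ j → z j ++ z j ≈ []
  z-square j with p j | hp j | relation⇒≈ (braid j)
  ... | .3 | inj₁ refl | z≈[]  = ≈-trans (++-congʳ (z j) z≈[]) z≈[]
  ... | .6 | inj₂ refl | z²≈[] = z²≈[]

  zAt-trivial : ∀ k → six k ≡ false → zAt k ≈ []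
  zAt-trivial k _ with p (clamp m k) | hp (clamp m k) | relation⇒≈ (braid (clamp m k))
  zAt-trivial k _  | .3 | inj₁ refl | z≈[] = z≈[]
  zAt-trivial k () | .6 | inj₂ refl | _

  -- Normal forms

  -- Exponents of z k, …, z (k + r - 1); an exponent is a Bool only where p = 6, as z = 1 elsewhere.
  Kernel : ℕ → ℕ → Set
  Kernel k zero    = ⊤
  Kernel k (suc r) = Bit (six k) × Kernel (suc k) r

  ε : ∀ k r → Kernel k r
  ε k zero    = tt
  ε k (suc r) = bitOff (six k) , ε (suc k) r

  zWord : ∀ k r → Kernel k r → Word L
  zWord k zero    _       = []
  zWord k (suc r) (b , κ) = bitWord b (zAt k) ++ zWord (suc k) r κ

  toggle : ∀ {k} r → ℕ → Kernel k r → Kernel k r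
  toggle zero    _       κ       = κ
  toggle (suc r) zero    (b , κ) = toggleBit b , κ
  toggle (suc r) (suc d) (b , κ) = b , toggle r d κ

  zWord-ε : ∀ k r → zWord k r (ε k r) ≡ []
  zWord-ε k zero    = refl
  zWord-ε k (suc r) with six k
  ... | true  = zWord-ε (suc k) r
  ... | false = zWord-ε (suc k) r

  zWord-central : ∀ {k r} κ → Central (zWord k r κ)
  zWord-central {k} {zero}  _       = []-central
  zWord-central {k} {suc r} (b , κ) = ++-central (bitWord-central b (z-central (clamp m k))) (zWord-central κ)

  z-absorb : ∀ k r d κ → d < r → zAt (k + d) ++ zWord k r κ ≈ zWord k r (toggle r d κ)
  z-absorb k (suc r) zero (b , κ) _ = begin
    zAt (k + 0) ++ B ++ Z      ≡⟨ cong (λ x → zAt x ++ B ++ Z) (+-identityʳ k) ⟩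
    zAt k ++ B ++ Z            ≡⟨ ++-assoc (zAt k) B Z ⟨
    (zAt k ++ B) ++ Z          ≈⟨ ++-congʳ Z (bitWord-toggle b (zAt-trivial k) (z-square _)) ⟩
    bitWord (toggleBit b) (zAt k) ++ Z ∎
    where
    open ≈-Reasoning
    B = bitWord b (zAt k)
    Z = zWord (suc k) r κ
  z-absorb k (suc r) (suc d) (b , κ) (s≤s d<r) = begin
    zAt (k + suc d) ++ B ++ Z  ≡⟨ cong (λ x → zAt x ++ B ++ Z) (+-suc k d) ⟩
    zAt (suc k + d) ++ B ++ Z  ≡⟨ ++-assoc (zAt (suc k + d)) B Z ⟨
    (zAt (suc k + d) ++ B) ++ Z ≈⟨ ++-congʳ Z (z-central _ B) ⟨
    (B ++ zAt (suc k + d)) ++ Z ≡⟨ ++-assoc B (zAt (suc k + d)) Z ⟩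
    B ++ zAt (suc k + d) ++ Z  ≈⟨ ++-congˡ B (z-absorb (suc k) r d κ d<r) ⟩
    B ++ zWord (suc k) r (toggle r d κ) ∎
    where
    open ≈-Reasoning
    B = bitWord b (zAt k)
    Z = zWord (suc k) r κ

  record Layer (T : ℕ) : Set where
    constructor layer
    field
      bottom size : ℕ
      fits        : bottom + size ≡ T

  layer-≡ : ∀ {T} {l l′ : Layer T} → Layer.bottom l ≡ Layer.bottom l′ → l ≡ l′
  layer-≡ {l = layer a n fit} {layer .a n′ fit′} refl with +-cancelˡ-≡ a n n′ (≡.trans fit (sym fit′))
  ... | refl = cong (layer a n) (≡-irrelevant fit fit′)

  Code : ℕ → Set
  Code zero    = ⊤
  Code (suc T) = Layer (suc T) × Code T

  desc : ℕ → ℕ → Word L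
  desc a zero    = []
  desc a (suc n) = desc (suc a) n ++ letter a ∷ []

  -- The T-th layer (bottom a, size n, a + n = T) spells ρ_{T-1} ⋯ ρ_a, so codeWord is the
  -- standard normal form for S_{T+1} = ⟨ρ₀, …, ρ_{T-1}⟩ with one coset representative per layer.
  layerWord : ∀ {T} → Layer T → Word L
  layerWord (layer a n _) = desc a n

  codeWord : ∀ T → Code T → Word L
  codeWord zero    _        = []
  codeWord (suc T) (l , cs) = codeWord T cs ++ layerWord l

  desc-split : ∀ a n₁ n₂ → desc a (n₁ + n₂) ≡ desc (a + n₁) n₂ ++ desc a n₁
  desc-split a zero n₂ = begin
    desc a n₂              ≡⟨ cong (λ b → desc b n₂) (+-identityʳ a) ⟨
    desc (a + 0) n₂        ≡⟨ ++-identityʳ _ ⟨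
    desc (a + 0) n₂ ++ []  ∎
    where open ≡.≡-Reasoning
  desc-split a (suc n₁) n₂ = begin
    desc (suc a) (n₁ + n₂) ++ letter a ∷ []
      ≡⟨ cong (_++ letter a ∷ []) (desc-split (suc a) n₁ n₂) ⟩
    (desc (suc a + n₁) n₂ ++ desc (suc a) n₁) ++ letter a ∷ []
      ≡⟨ ++-assoc (desc (suc a + n₁) n₂) _ _ ⟩
    desc (suc a + n₁) n₂ ++ desc a (suc n₁)
      ≡⟨ cong (λ b → desc b n₂ ++ desc a (suc n₁)) (+-suc a n₁) ⟨
    desc (a + suc n₁) n₂ ++ desc a (suc n₁) ∎
    where open ≡.≡-Reasoning

  desc-letters : ∀ a n → a + n ≤ L → All (λ x → a ≤ toℕ x × toℕ x < a + n) (desc a n)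
  desc-letters a zero    _     = []
  desc-letters a (suc n) a+n≤L =
    All.++⁺ (All.map widen (desc-letters (suc a) n (subst (_≤ L) (+-suc a n) a+n≤L)))
            ((≤-reflexive (sym a≡) , subst (_< a + suc n) (sym a≡) (m<m+n a (s≤s z≤n))) ∷ [])
    where
    a≡ : toℕ (letter a) ≡ a
    a≡ = toℕ-clamp (≤-pred (≤-trans (m<m+n a (s≤s z≤n)) a+n≤L))
    widen : ∀ {x} → suc a ≤ toℕ x × toℕ x < suc a + n → a ≤ toℕ x × toℕ x < a + suc n
    widen {x} (lo , hi) = ≤-trans (n≤1+n a) lo , subst (toℕ x <_) (sym (+-suc a n)) hi

  desc-far-below : ∀ i a n → 2 + i ≤ a → a + n ≤ L → All (Far (letter i)) (desc a n)
  desc-far-below i a n i+2≤a a+n≤L = All.map far (desc-letters a n a+n≤L)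
    where
    i≡ : toℕ (letter i) ≡ i
    i≡ = toℕ-clamp (≤-pred (≤-trans (≤-trans (n≤1+n (suc i)) i+2≤a) (≤-trans (m≤m+n a n) a+n≤L)))
    far : ∀ {y} → a ≤ toℕ y × toℕ y < a + n → Far (letter i) y
    far {y} (a≤y , _) = subst (λ x → 2 ≤ ∣ x - toℕ y ∣) (sym i≡) (gap≥2 (≤-trans i+2≤a a≤y))

  desc-far-above : ∀ i a n → suc (a + n) ≤ i → i ≤ suc m → All (Far (letter i)) (desc a n)
  desc-far-above i a n a+n<i i≤m+1 =
    All.map far (desc-letters a n (≤-trans (≤-trans (n≤1+n _) a+n<i) (≤-trans i≤m+1 (n≤1+n (suc m)))))
    where
    far : ∀ {y} → a ≤ toℕ y × toℕ y < a + n → Far (letter i) y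
    far {y} (_ , y<a+n) = subst (λ x → 2 ≤ ∣ x - toℕ y ∣) (sym (toℕ-clamp i≤m+1)) (gap≥2′ (≤-trans (s≤s y<a+n) a+n<i))

  desc-far : ∀ i a n → 2 + i ≤ a → a + n ≤ L → desc a n ++ letter i ∷ [] ≈ letter i ∷ desc a n
  desc-far i a n i+2≤a a+n≤L = far-comm-word (desc a n) (desc-far-below i a n i+2≤a a+n≤L)

  desc-braid : ∀ a k n → a + n ≤ L → 2 + (a + k) ≤ a + n →
               desc a n ++ letter (suc (a + k)) ∷ [] ≈ letter (a + k) ∷ desc a n ++ zAt (a + k)
  desc-braid a k n a+n≤L j+2≤a+n with m≤n⇒∃[o]m+o≡n k+2≤n
    where
    k+2≤n : k + 2 ≤ n
    k+2≤n = +-cancelˡ-≤ a _ _ (subst (_≤ a + n) (≡.trans (+-comm 2 (a + k)) (+-assoc a k 2)) j+2≤a+n)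
  ... | o , refl = begin
    desc a n ++ X ∷ []                  ≡⟨ cong (_++ X ∷ []) split ⟩
    (U ++ X ∷ Y ∷ D) ++ X ∷ []          ≡⟨ ++-assoc U (X ∷ Y ∷ D) (X ∷ []) ⟩
    U ++ X ∷ Y ∷ D ++ X ∷ []            ≈⟨ ++-congˡ U (++-congˡ (X ∷ Y ∷ []) (far-comm-word D farD)) ⟩
    U ++ (X ∷ Y ∷ X ∷ []) ++ D          ≈⟨ ++-congˡ U (++-congʳ D braid-XY) ⟩
    U ++ Y ∷ X ∷ Y ∷ zAt j ++ D         ≈⟨ ++-congˡ U (++-congˡ (Y ∷ X ∷ Y ∷ []) (z-central _ D)) ⟨
    U ++ Y ∷ X ∷ Y ∷ D ++ zAt j         ≡⟨ ++-assoc U (Y ∷ []) _ ⟨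
    (U ++ Y ∷ []) ++ X ∷ Y ∷ D ++ zAt j ≈⟨ ++-congʳ _ (far-comm-word U farU) ⟩
    Y ∷ U ++ X ∷ Y ∷ D ++ zAt j         ≡⟨ cong (Y ∷_) (++-assoc U (X ∷ Y ∷ D) (zAt j)) ⟨
    Y ∷ (U ++ X ∷ Y ∷ D) ++ zAt j       ≡⟨ cong (λ w → Y ∷ w ++ zAt j) split ⟨
    Y ∷ desc a n ++ zAt j               ∎
    where
    open ≈-Reasoning
    j = a + k
    X = letter (suc j)
    Y = letter j
    U = desc (a + (k + 2)) o
    D = desc a k
    j≤m : j ≤ m
    j≤m = ≤-pred (≤-pred (≤-trans j+2≤a+n a+n≤L))
    split : desc a (k + 2 + o) ≡ U ++ X ∷ Y ∷ D
    split = ≡.trans (desc-split a (k + 2) o) (cong (U ++_) (desc-split a k 2))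
    braid-XY : X ∷ Y ∷ X ∷ [] ≈ Y ∷ X ∷ Y ∷ zAt j
    braid-XY = subst (λ y → X ∷ y ∷ X ∷ [] ≈ y ∷ X ∷ y ∷ zAt j) (inject₁-clamp j≤m) (braid-z (clamp m j))
    farD : All (Far X) D
    farD = desc-far-above (suc j) a k ≤-refl (s≤s j≤m)
    farU : All (Far Y) U
    farU = desc-far-below j (a + (k + 2)) o (≤-reflexive (≡.trans (+-comm 2 j) (+-assoc a k 2)))
                          (subst (_≤ L) (sym (+-assoc a (k + 2) o)) a+n≤L)

  data Position : ℕ → ℕ → Set where
    far-below  : ∀ i k → Position i (suc (suc (i + k)))
    just-below : ∀ i → Position i (suc i)
    at-bottom  : ∀ i → Position i i
    above      : ∀ a k → Position (suc (a + k)) a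

  position : ∀ i a → Position i a
  position zero    zero          = at-bottom zero
  position zero    (suc zero)    = just-below zero
  position zero    (suc (suc k)) = far-below zero k
  position (suc i) zero          = above zero i
  position (suc i) (suc a)       with position i a
  ... | far-below i k = far-below (suc i) k
  ... | just-below i  = just-below (suc i)
  ... | at-bottom i   = at-bottom (suc i)
  ... | above a k     = above (suc a) k

  K : Set
  K = Kernel 0 (suc m)

  nfWord : ∀ T → Code T × K → Word L
  nfWord T (cs , κ) = codeWord T cs ++ zWord 0 (suc m) κ

  -- The empty case is junk: step only drops the bottom of a layer for letters i < T, and those
  -- never sit at the bottom of an empty layer.
  dropBottom : ∀ {T} → Layer T → Layer T
  dropBottom (layer a zero    fit) = layer a zero fit
  dropBottom (layer a (suc n) fit) = layer (suc a) n (≡.trans (sym (+-suc a n)) fit)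

  push : ∀ {T} → Layer (suc T) → Code T × K → Code (suc T) × K
  push l (cs , κ) = (l , cs) , κ

  step : ∀ T → Code T × K → ℕ → Code T × K
  step zero    x                          i = x
  step (suc T) ((layer a n fit , cs) , κ) i with position i a
  ... | far-below i k = push (layer _ n fit) (step T (cs , κ) i)
  ... | just-below i  = (layer i (suc n) (≡.trans (+-suc i n) fit) , cs) , κ
  ... | at-bottom i   = (dropBottom (layer i n fit) , cs) , κ
  ... | above a k     = push (layer a n fit) (step T (cs , toggle (suc m) (a + k) κ) (a + k))

  dropBottom-≈ : ∀ {T} i n (fit : i + n ≡ T) → i < T →
                 desc i n ++ letter i ∷ [] ≈ layerWord (dropBottom (layer i n fit))
  dropBottom-≈ i zero    fit i<T = ⊥-elim (<-irrefl (≡.trans (sym (+-identityʳ i)) fit) i<T)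
  dropBottom-≈ i (suc n) fit _   = begin
    (desc (suc i) n ++ letter i ∷ []) ++ letter i ∷ [] ≡⟨ ++-assoc (desc (suc i) n) _ _ ⟩
    desc (suc i) n ++ letter i ∷ letter i ∷ []         ≈⟨ ++-congˡ (desc (suc i) n) (involution (letter i)) ⟩
    desc (suc i) n ++ []                               ≡⟨ ++-identityʳ _ ⟩
    desc (suc i) n                                     ∎
    where open ≈-Reasoning

  through-layer : ∀ {T} (l : Layer (suc T)) cs κ κ′ {c} i j r →
                  layerWord l ++ letter i ∷ [] ≈ letter j ∷ layerWord l ++ c →
                  c ++ zWord 0 (suc m) κ ≈ zWord 0 (suc m) κ′ →
                  nfWord T (cs , κ′) ++ letter j ∷ [] ≈ nfWord T r →
                  nfWord (suc T) ((l , cs) , κ) ++ letter i ∷ [] ≈ nfWord (suc T) (push l r)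
  through-layer {T} l cs κ κ′ i j r pass absorb rest = begin
    ((C ++ D) ++ Z) ++ letter i ∷ []   ≈⟨ pass-through C D (zWord-central κ) (zWord-central κ′) pass absorb ⟩
    ((C ++ Z′) ++ letter j ∷ []) ++ D  ≈⟨ ++-congʳ D rest ⟩
    nfWord T r ++ D                    ≈⟨ central-swap (codeWord T (proj₁ r)) D (zWord-central (proj₂ r)) ⟩
    nfWord (suc T) (push l r)          ∎
    where
    open ≈-Reasoning
    C = codeWord T cs
    D = layerWord l
    Z = zWord 0 (suc m) κ
    Z′ = zWord 0 (suc m) κ′

  step-correct : ∀ T x i → T ≤ L → i < T → nfWord T x ++ letter i ∷ [] ≈ nfWord T (step T x i)
  step-correct zero    _                          _ _   ()
  step-correct (suc T) ((layer a n fit , cs) , κ) i T<L i<T with position i a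
  ... | far-below i k =
    through-layer (layer _ n fit) cs κ κ i i (step T (cs , κ) i) D-far ≈-refl
                  (step-correct T (cs , κ) i (<⇒≤ T<L) (≤-pred (≤-trans (s≤s (s≤s (m≤m+n i k))) a≤T)))
    where
    D = desc (suc (suc (i + k))) n
    a≤T : suc (suc (i + k)) ≤ suc T
    a≤T = subst (suc (suc (i + k)) ≤_) fit (m≤m+n _ n)
    D-far : D ++ letter i ∷ [] ≈ letter i ∷ D ++ []
    D-far = ≈-trans (desc-far i _ n (s≤s (s≤s (m≤m+n i k))) (subst (_≤ L) (sym fit) T<L))
                    (≈-reflexive (cong (letter i ∷_) (sym (++-identityʳ D))))
  ... | just-below i  = replace-last (codeWord T cs) (desc (suc i) n) (zWord-central κ) ≈-refl
  ... | at-bottom i   = replace-last (codeWord T cs) (desc i n) (zWord-central κ) (dropBottom-≈ i n fit i<T)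
  ... | above a k     =
    through-layer (layer a n fit) cs κ κ′ i j (step T (cs , κ′) j)
                  (desc-braid a k n (subst (_≤ L) (sym fit) T<L) (subst (suc (suc j) ≤_) (sym fit) i<T))
                  (z-absorb 0 (suc m) j κ (≤-trans (≤-pred i<T) (≤-pred T<L)))
                  (step-correct T (cs , κ′) j (<⇒≤ T<L) (≤-pred i<T))
    where
    j = a + k
    κ′ = toggle (suc m) j κ

  module _ (P : Fin L → Set) where

    remove-middle : ∀ C D Z → All P ((C ++ D) ++ Z) → All P (C ++ Z) × All P D
    remove-middle C D Z all = All.++⁺ PC PZ , PD
      where
      PCD = All.++⁻ˡ (C ++ D) all
      PZ  = All.++⁻ʳ (C ++ D) all
      PC  = All.++⁻ˡ C PCD
      PD  = All.++⁻ʳ C PCD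

    insert-middle : ∀ C D Z → All P (C ++ Z) → All P D → All P ((C ++ D) ++ Z)
    insert-middle C D Z PCZ PD = All.++⁺ (All.++⁺ (All.++⁻ˡ C PCZ) PD) (All.++⁻ʳ C PCZ)

    desc-lookup : ∀ {a x} n → All P (desc a n) → a ≤ x → x < a + n → P (letter x)
    desc-lookup {a} {x} zero    _   a≤x x<a+0 = ⊥-elim (<⇒≱ (subst (x <_) (+-identityʳ a) x<a+0) a≤x)
    desc-lookup {a} {x} (suc n) all a≤x x<a+n with m≤n⇒m<n∨m≡n a≤x
    ... | inj₂ refl = All.head (All.++⁻ʳ (desc (suc a) n) all)
    ... | inj₁ a<x  = desc-lookup n (All.++⁻ˡ (desc (suc a) n) all) a<x (subst (x <_) (+-suc a n) x<a+n)

    zAt-support : ∀ {j} → j ≤ m → P (letter j) → P (letter (suc j)) → All P (zAt j)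
    zAt-support j≤m Pj Pj+1 = Pj′ ∷ Pj+1 ∷ Pj′ ∷ Pj+1 ∷ Pj′ ∷ Pj+1 ∷ []
      where Pj′ = subst P (sym (inject₁-clamp j≤m)) Pj

    toggle-support : ∀ k r d κ → All P (zAt (k + d)) → All P (zWord k r κ) → All P (zWord k r (toggle r d κ))
    toggle-support k zero    d       κ       _  all = all
    toggle-support k (suc r) zero    (b , κ) Pz all =
      All.++⁺ (bitWord-support (toggleBit b) (subst (λ x → All P (zAt x)) (+-identityʳ k) Pz))
              (All.++⁻ʳ (bitWord b (zAt k)) all)
    toggle-support k (suc r) (suc d) (b , κ) Pz all =
      All.++⁺ (All.++⁻ˡ (bitWord b (zAt k)) all)
              (toggle-support (suc k) r d κ (subst (λ x → All P (zAt x)) (+-suc k d) Pz)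
                              (All.++⁻ʳ (bitWord b (zAt k)) all))

    dropBottom-support : ∀ {T} i n (fit : i + n ≡ T) → All P (desc i n) →
                         All P (layerWord (dropBottom (layer i n fit)))
    dropBottom-support i zero    fit all = all
    dropBottom-support i (suc n) fit all = All.++⁻ˡ (desc (suc i) n) all

    step-support : ∀ T x i → T ≤ L → i < T → All P (nfWord T x) → P (letter i) → All P (nfWord T (step T x i))
    step-support zero    _                          _ _   ()
    step-support (suc T) ((layer a n fit , cs) , κ) i T<L i<T all Pi with position i a
    ... | far-below i k =
      let PCZ , PD = remove-middle (codeWord T cs) (desc _ n) _ all
          i<T′     = ≤-pred (≤-trans (s≤s (s≤s (m≤m+n i k))) (subst (suc (suc (i + k)) ≤_) fit (m≤m+n _ n)))
          r        = step T (cs , κ) i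
      in insert-middle (codeWord T (proj₁ r)) (desc _ n) _ (step-support T (cs , κ) i (<⇒≤ T<L) i<T′ PCZ Pi) PD
    ... | just-below i  =
      let PCZ , PD = remove-middle (codeWord T cs) (desc (suc i) n) _ all
      in insert-middle (codeWord T cs) (desc i (suc n)) _ PCZ (All.++⁺ PD (Pi ∷ []))
    ... | at-bottom i   =
      let PCZ , PD = remove-middle (codeWord T cs) (desc i n) _ all
      in insert-middle (codeWord T cs) _ _ PCZ (dropBottom-support i n fit PD)
    ... | above a k     =
      let PCZ , PD = remove-middle (codeWord T cs) (desc a n) _ all
          j        = a + k
          j+1<a+n  = subst (suc (suc j) ≤_) (sym fit) i<T
          Pj       = desc-lookup n PD (m≤m+n a k) (≤-trans (n≤1+n _) j+1<a+n)
          Pj+1     = desc-lookup n PD (≤-trans (m≤m+n a k) (n≤1+n j)) j+1<a+n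
          Pz       = zAt-support (≤-pred (≤-pred (≤-trans i<T T<L))) Pj Pj+1
          κ′       = toggle (suc m) j κ
          PCZ′     = All.++⁺ (All.++⁻ˡ (codeWord T cs) PCZ)
                             (toggle-support 0 (suc m) j κ Pz (All.++⁻ʳ (codeWord T cs) PCZ))
          r        = step T (cs , κ′) j
      in insert-middle (codeWord T (proj₁ r)) (desc a n) _
                       (step-support T (cs , κ′) j (<⇒≤ T<L) (≤-pred i<T) PCZ′ Pj) PD

  identityCode : ∀ T → Code T
  identityCode zero    = tt
  identityCode (suc T) = layer (suc T) 0 (+-identityʳ _) , identityCode T

  codeWord-identity : ∀ T → codeWord T (identityCode T) ≡ []
  codeWord-identity zero    = refl
  codeWord-identity (suc T) = ≡.trans (++-identityʳ _) (codeWord-identity T)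

  Normal : Set
  Normal = Code L × K

  ⟦_⟧ : Normal → Word L
  ⟦_⟧ = nfWord L

  one : Normal
  one = identityCode L , ε 0 (suc m)

  ⟦one⟧ : ⟦ one ⟧ ≡ []
  ⟦one⟧ = ≡.trans (cong (_++ zWord 0 (suc m) (ε 0 (suc m))) (codeWord-identity L)) (zWord-ε 0 (suc m))

  _·_ : Normal → Fin L → Normal
  x · i = step L x (toℕ i)

  normalise : Word L → Normal
  normalise = foldl _·_ one

  ·-correct : ∀ x i → ⟦ x ⟧ ++ i ∷ [] ≈ ⟦ x · i ⟧
  ·-correct x i = subst (λ y → ⟦ x ⟧ ++ y ∷ [] ≈ ⟦ x · i ⟧) (clamp-toℕ i) (step-correct L x (toℕ i) ≤-refl (toℕ<n i))

  foldl-correct : ∀ x w → ⟦ x ⟧ ++ w ≈ ⟦ foldl _·_ x w ⟧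
  foldl-correct x []      = ≈-reflexive (++-identityʳ ⟦ x ⟧)
  foldl-correct x (i ∷ w) = begin
    ⟦ x ⟧ ++ i ∷ w            ≡⟨ ++-assoc ⟦ x ⟧ (i ∷ []) w ⟨
    (⟦ x ⟧ ++ i ∷ []) ++ w    ≈⟨ ++-congʳ w (·-correct x i) ⟩
    ⟦ x · i ⟧ ++ w            ≈⟨ foldl-correct (x · i) w ⟩
    ⟦ foldl _·_ (x · i) w ⟧   ∎
    where open ≈-Reasoning

  normalise-correct : ∀ w → w ≈ ⟦ normalise w ⟧
  normalise-correct w = ≈-trans (≈-reflexive (cong (_++ w) (sym ⟦one⟧))) (foldl-correct one w)

  normalise-support : ∀ (P : Fin L → Set) w → All P w → All P ⟦ normalise w ⟧
  normalise-support P = go one (subst (All P) (sym ⟦one⟧) [])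
    where
    go : ∀ x → All P ⟦ x ⟧ → ∀ w → All P w → All P ⟦ foldl _·_ x w ⟧
    go x Px []      []         = Px
    go x Px (i ∷ w) (Pi ∷ Pw) =
      go (x · i) (step-support P L x (toℕ i) ≤-refl (toℕ<n i) Px (subst P (sym (clamp-toℕ i)) Pi)) w Pw

  -- Uniqueness of normal forms

  z-fixes′ : ∀ j (s : List ℕ) → length s ≡ suc L → permute s (z j) ≡ s
  z-fixes′ j s len = z-fixes j s (subst (suc (2 + toℕ j) ≤_) (sym len) (s≤s (s≤s (s≤s (≤-pred (toℕ<n j))))))

  zWord-fixes : ∀ k r κ (s : List ℕ) → length s ≡ suc L → permute s (zWord k r κ) ≡ s
  zWord-fixes k zero    _       s _   = refl
  zWord-fixes k (suc r) (b , κ) s len =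
    ≡.trans (foldl-++ swapAt s (bitWord b (zAt k)) _)
            (≡.trans (cong (λ t → permute t (zWord (suc k) r κ)) (bit-fixes b)) (zWord-fixes (suc k) r κ s len))
    where
    bit-fixes : ∀ {s′} (b : Bit s′) → permute s (bitWord b (zAt k)) ≡ s
    bit-fixes {true}  true  = z-fixes′ (clamp m k) s len
    bit-fixes {true}  false = refl
    bit-fixes {false} tt    = refl

  permute-respects : ∀ {u v} → u ≈ v → ∀ (s : List ℕ) → length s ≡ suc L → permute s u ≡ permute s v
  permute-respects = action-respects-≈ swapAt (λ s → length s ≡ suc L)
                                      (λ s i len → ≡.trans (length-swap (toℕ i) s) len) respects
    where
    respects : ∀ {l r} → Rel p l r → ∀ (s : List ℕ) → length s ≡ suc L → permute s l ≡ permute s r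
    respects (invol i)        s _   = swap-involutive (toℕ i) s
    respects (braid j)        s len with p j | hp j
    ... | .3 | inj₁ refl = z-fixes′ j s len
    ... | .6 | inj₂ refl = ≡.trans (cong (λ t → permute t (z j)) (z-fixes′ j s len)) (z-fixes′ j s len)
    respects (commute i k far) s _  = begin
      swap b (swap a (swap b (swap a s))) ≡⟨ cong (swap b) (swap-comm a b (swap a s) far) ⟩
      swap b (swap b (swap a (swap a s))) ≡⟨ swap-involutive b _ ⟩
      swap a (swap a s)                   ≡⟨ swap-involutive a s ⟩
      s                                   ∎
      where
      open ≡.≡-Reasoning
      a = toℕ i
      b = toℕ k
    respects (central j k)    s len = begin
      permute (swap (toℕ k) s) (z j)          ≡⟨ z-fixes′ j _ (≡.trans (length-swap (toℕ k) s) len) ⟩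
      swap (toℕ k) s                          ≡⟨ cong (swap (toℕ k)) (z-fixes′ j s len) ⟨
      swap (toℕ k) (permute s (z j))          ≡⟨ foldl-++ swapAt s (z j) (k ∷ []) ⟨
      permute s (z j ++ k ∷ [])               ∎
      where open ≡.≡-Reasoning

  desc-inserts : ∀ {A : Set} a n (x : A) xs ys → length xs ≡ a + n → a + n ≤ L →
                 permute (xs ++ x ∷ ys) (desc a n) ≡ insertAt a x xs ++ ys
  desc-inserts a zero    x xs ys len _     = begin
    xs ++ x ∷ ys                     ≡⟨ ++-assoc xs (x ∷ []) ys ⟨
    (xs ++ x ∷ []) ++ ys             ≡⟨ cong (_++ ys) (insertAt-last x xs) ⟨
    insertAt (length xs) x xs ++ ys  ≡⟨ cong (λ b → insertAt b x xs ++ ys) (≡.trans len (+-identityʳ a)) ⟩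
    insertAt a x xs ++ ys            ∎
    where open ≡.≡-Reasoning
  desc-inserts a (suc n) x xs ys len a+n≤L = begin
    permute (xs ++ x ∷ ys) (desc (suc a) n ++ letter a ∷ [])
      ≡⟨ foldl-++ swapAt (xs ++ x ∷ ys) (desc (suc a) n) _ ⟩
    swap (toℕ (letter a)) (permute (xs ++ x ∷ ys) (desc (suc a) n))
      ≡⟨ cong₂ swap a≡ (desc-inserts (suc a) n x xs ys (≡.trans len (+-suc a n)) (subst (_≤ L) (+-suc a n) a+n≤L)) ⟩
    swap a (insertAt (suc a) x xs ++ ys)
      ≡⟨ swap-insertAt a x xs ys (subst (a <_) (sym len) (m<m+n a (s≤s z≤n))) ⟩
    insertAt a x xs ++ ys ∎
    where
    open ≡.≡-Reasoning
    a≡ : toℕ (letter a) ≡ a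
    a≡ = toℕ-clamp (≤-pred (≤-trans (m<m+n a (s≤s z≤n)) a+n≤L))

  codeWord-letters : ∀ T cs → T ≤ L → All (λ i → toℕ i < T) (codeWord T cs)
  codeWord-letters zero    _                        _   = []
  codeWord-letters (suc T) (layer a n fit , cs) T≤L =
    All.++⁺ (All.map (λ lt → ≤-trans lt (n≤1+n T)) (codeWord-letters T cs (<⇒≤ T≤L)))
            (All.map (λ {i} (_ , lt) → subst (toℕ i <_) fit lt) (desc-letters a n (subst (_≤ L) (sym fit) T≤L)))

  perm : ∀ T → Code T → List ℕ
  perm T cs = permute (upTo (suc T)) (codeWord T cs)

  length-perm : ∀ T cs → length (perm T cs) ≡ suc T
  length-perm T cs = ≡.trans (length-permute (upTo (suc T)) (codeWord T cs)) (length-upTo (suc T))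

  perm-bounded : ∀ T cs → All (_< suc T) (perm T cs)
  perm-bounded T cs = permute-All (codeWord T cs) (All.applyUpTo⁺₁ id (suc T) id)

  perm-step : ∀ T a n fit cs → suc T ≤ L → perm (suc T) (layer a n fit , cs) ≡ insertAt a (suc T) (perm T cs)
  perm-step T a n fit cs T<L = begin
    permute (upTo (suc (suc T))) (codeWord T cs ++ desc a n)
      ≡⟨ cong (λ s → permute s (codeWord T cs ++ desc a n)) (upTo-∷ʳ (suc T)) ⟨
    permute (upTo (suc T) ++ suc T ∷ []) (codeWord T cs ++ desc a n)
      ≡⟨ foldl-++ swapAt _ (codeWord T cs) (desc a n) ⟩
    permute (permute (upTo (suc T) ++ suc T ∷ []) (codeWord T cs)) (desc a n)
      ≡⟨ cong (λ s → permute s (desc a n)) prefix ⟩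
    permute (perm T cs ++ suc T ∷ []) (desc a n)
      ≡⟨ desc-inserts a n (suc T) (perm T cs) [] (≡.trans (length-perm T cs) (sym fit)) (subst (_≤ L) (sym fit) T<L) ⟩
    insertAt a (suc T) (perm T cs) ++ []
      ≡⟨ ++-identityʳ _ ⟩
    insertAt a (suc T) (perm T cs) ∎
    where
    open ≡.≡-Reasoning
    prefix : permute (upTo (suc T) ++ suc T ∷ []) (codeWord T cs) ≡ perm T cs ++ suc T ∷ []
    prefix = permute-++ (codeWord T cs) (upTo (suc T)) (suc T ∷ [])
               (All.map (λ {i} lt → subst (suc (toℕ i) <_) (sym (length-upTo (suc T))) (s≤s lt))
                        (codeWord-letters T cs (<⇒≤ T<L)))

  perm-injective : ∀ T cs cs′ → T ≤ L → perm T cs ≡ perm T cs′ → cs ≡ cs′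
  perm-injective zero    _ _ _ _ = refl
  perm-injective (suc T) (layer a n fit , cs) (layer a′ n′ fit′ , cs′) T<L eq
    with insertAt-injective a a′ (perm T cs) (perm T cs′) (perm-bounded T cs) (perm-bounded T cs′)
                            (bottom≤ a n fit cs) (bottom≤ a′ n′ fit′ cs′)
                            (≡.trans (sym (perm-step T a n fit cs T<L)) (≡.trans eq (perm-step T a′ n′ fit′ cs′ T<L)))
    where
    bottom≤ : ∀ a n → a + n ≡ suc T → ∀ cs → a ≤ length (perm T cs)
    bottom≤ a n fit cs = subst (a ≤_) (≡.trans fit (sym (length-perm T cs))) (m≤m+n a n)
  ... | refl , perm≡ with +-cancelˡ-≡ a n n′ (≡.trans fit (sym fit′))
  ... | refl = cong₂ _,_ (cong (layer a n) (≡-irrelevant fit fit′)) (perm-injective T cs cs′ (<⇒≤ T<L) perm≡)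

  parity-respects : ∀ j → six j ≡ true → ∀ {u v} → u ≈ v → ∀ b → parity j b u ≡ parity j b v
  parity-respects j six-j u≈v b = action-respects-≈ (flipBelow j) (λ _ → ⊤) (λ _ _ _ → tt) respects u≈v b tt
    where
    respects : ∀ {l r} → Rel p l r → ∀ b → ⊤ → parity j b l ≡ parity j b r
    respects (invol i)        b _ = xor-cancelʳ b _
    respects (commute i k _)  b _ = alternate-2 b _ _
    respects (central j′ k)   b _ = alternate-xor 3 b _ _ _
    respects (braid j′)       b _ with hp j′
    ... | inj₂ p≡6 rewrite p≡6 = ≡.trans (parity-adj j j′ b 6) (alternate-6 b _ _)
    ... | inj₁ p≡3 rewrite p≡3 =
      ≡.trans (parity-adj j j′ b 3)
              (≡.trans (cong (λ c → alternate 3 b c (suc (toℕ j′) ≤ᵇ j)) c≡d) (alternate-same 3 b _))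
      where
      -- ρ_{j′} ρ_{j′+1} flips the parity j only when j = j′, which needs p j′ = 6
      j′≢j : toℕ j′ ≢ j
      j′≢j j′≡j with ≡.trans (sym (six-toℕ j′)) (≡.trans (cong six j′≡j) six-j)
      ... | six-j′ rewrite p≡3 = case six-j′ of λ ()
      c≡d : (toℕ (inject₁ j′) ≤ᵇ j) ≡ (suc (toℕ j′) ≤ᵇ j)
      c≡d = ≡.trans (cong (_≤ᵇ j) (toℕ-inject₁ j′)) (≤ᵇ-step (toℕ j′) j j′≢j)

  parity-zAt : ∀ {j k} y → k ≤ m → parity j y (zAt k) ≡ alternate 3 y (k ≤ᵇ j) (suc k ≤ᵇ j)
  parity-zAt {j} {k} y k≤m = ≡.trans (parity-adj j (clamp m k) y 3)
    (cong₂ (alternate 3 y) (cong (_≤ᵇ j) (≡.trans (toℕ-inject₁ _) k≡)) (cong (λ x → suc x ≤ᵇ j) k≡))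
    where k≡ = toℕ-clamp k≤m

  parity-bitWord-other : ∀ {j k s} y (b : Bit s) → k ≤ m → k ≢ j → parity j y (bitWord b (zAt k)) ≡ y
  parity-bitWord-other {j} {k} {true} y true k≤m k≢j =
    ≡.trans (parity-zAt y k≤m)
            (≡.trans (cong (λ c → alternate 3 y c (suc k ≤ᵇ j)) (≤ᵇ-step k j k≢j)) (alternate-same 3 y _))
  parity-bitWord-other {s = true}  y false _   _   = refl
  parity-bitWord-other {s = false} y tt    _   _   = refl

  parity-bitWord-self : ∀ {k s} y (b : Bit s) → k ≤ m → parity k y (bitWord b (zAt k)) ≡ y xor bitValue b
  parity-bitWord-self {k} {true}  y true  k≤m = begin
    parity k y (zAt k)                  ≡⟨ parity-zAt y k≤m ⟩
    alternate 3 y (k ≤ᵇ k) (suc k ≤ᵇ k) ≡⟨ cong₂ (alternate 3 y) (≤ᵇ-true (≤-refl {k})) (≤ᵇ-false {suc k} {k} (<-irrefl refl)) ⟩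
    alternate 3 y true false            ≡⟨ alternate-3 y ⟩
    not y                               ≡⟨ xor-comm true y ⟩
    y xor true                          ∎
    where open ≡.≡-Reasoning
  parity-bitWord-self {s = true}  y false _ = sym (xor-identityʳ y)
  parity-bitWord-self {s = false} y tt    _ = sym (xor-identityʳ y)

  parity-zWord-above : ∀ {j} k r κ y → j < k → k + r ≤ suc m → parity j y (zWord k r κ) ≡ y
  parity-zWord-above k zero    _       y _   _     = refl
  parity-zWord-above {j} k (suc r) (b , κ) y j<k bound = begin
    parity j y (bitWord b (zAt k) ++ zWord (suc k) r κ)
      ≡⟨ parity-++ j y (bitWord b (zAt k)) _ ⟩
    parity j (parity j y (bitWord b (zAt k))) (zWord (suc k) r κ)
      ≡⟨ cong (λ x → parity j x (zWord (suc k) r κ)) (parity-bitWord-other y b k≤m (<⇒≢ j<k ∘ sym)) ⟩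
    parity j y (zWord (suc k) r κ)
      ≡⟨ parity-zWord-above (suc k) r κ y (≤-trans j<k (n≤1+n k)) bound′ ⟩
    y ∎
    where
    open ≡.≡-Reasoning
    bound′ = subst (_≤ suc m) (+-suc k r) bound
    k≤m = ≤-pred (≤-trans (s≤s (m≤m+n k r)) bound′)

  zWord-injective : ∀ k r (κ κ′ : Kernel k r) → k + r ≤ suc m → (y : ℕ → Bool) →
                    (∀ j → six j ≡ true → parity j (y j) (zWord k r κ) ≡ parity j (y j) (zWord k r κ′)) → κ ≡ κ′
  zWord-injective k zero    _       _         _     _ _    = refl
  zWord-injective k (suc r) (b , κ) (b′ , κ′) bound y same
    with bit-injective b b′ (λ six-k → xor-cancelˡ (y k) _ _ (≡.trans (sym (head b κ))
                                                                      (≡.trans (same k six-k) (head b′ κ′))))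
    where
    bound′ = subst (_≤ suc m) (+-suc k r) bound
    k≤m = ≤-pred (≤-trans (s≤s (m≤m+n k r)) bound′)
    head : ∀ b κ → parity k (y k) (zWord k (suc r) (b , κ)) ≡ y k xor bitValue b
    head b κ = ≡.trans (parity-++ k (y k) (bitWord b (zAt k)) _)
                       (≡.trans (parity-zWord-above (suc k) r κ _ ≤-refl bound′) (parity-bitWord-self (y k) b k≤m))
  ... | refl = cong (b ,_) (zWord-injective (suc k) r κ κ′ (subst (_≤ suc m) (+-suc k r) bound)
                              (λ j → parity j (y j) (bitWord b (zAt k))) tail-same)
    where
    tail-same : ∀ j → six j ≡ true → parity j (parity j (y j) (bitWord b (zAt k))) (zWord (suc k) r κ)
                                   ≡ parity j (parity j (y j) (bitWord b (zAt k))) (zWord (suc k) r κ′)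
    tail-same j six-j = ≡.trans (sym (parity-++ j (y j) (bitWord b (zAt k)) _))
                                (≡.trans (same j six-j) (parity-++ j (y j) (bitWord b (zAt k)) _))

  ⟦⟧-injective : ∀ x y → ⟦ x ⟧ ≈ ⟦ y ⟧ → x ≡ y
  ⟦⟧-injective (cs , κ) (cs′ , κ′) eq with perm-injective L cs cs′ ≤-refl perm≡
    where
    start = upTo (suc L)
    permute-⟦⟧ : ∀ cs κ → permute start ⟦ cs , κ ⟧ ≡ perm L cs
    permute-⟦⟧ cs κ = ≡.trans (foldl-++ swapAt start (codeWord L cs) _) (zWord-fixes 0 (suc m) κ _ (length-perm L cs))
    perm≡ = ≡.trans (sym (permute-⟦⟧ cs κ)) (≡.trans (permute-respects eq start (length-upTo _)) (permute-⟦⟧ cs′ κ′))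
  ... | refl = cong (cs ,_) (zWord-injective 0 (suc m) κ κ′ ≤-refl (λ j → parity j false (codeWord L cs)) parity≡)
    where
    parity≡ : ∀ j → six j ≡ true → parity j (parity j false (codeWord L cs)) (zWord 0 (suc m) κ)
                                  ≡ parity j (parity j false (codeWord L cs)) (zWord 0 (suc m) κ′)
    parity≡ j six-j = ≡.trans (sym (parity-++ j false (codeWord L cs) _))
                              (≡.trans (parity-respects j six-j eq false) (parity-++ j false (codeWord L cs) _))

  -- Counting

  Fin↔Layer : ∀ T → Fin (suc T) ↔ Layer T
  Fin↔Layer T = mk↔ₛ′ to from (λ l → layer-≡ (toℕ-fromℕ< _)) (λ a → fromℕ<-toℕ a _)
    where
    to : Fin (suc T) → Layer T
    to a = layer (toℕ a) (T ∸ toℕ a) (m+[n∸m]≡n (≤-pred (toℕ<n a)))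
    from : Layer T → Fin (suc T)
    from (layer a n fit) = fromℕ< (s≤s (subst (a ≤_) fit (m≤m+n a n)))

  Fin↔Code : ∀ T → Fin (suc T !) ↔ Code T
  Fin↔Code zero    = 1↔⊤
  Fin↔Code (suc T) = ↔-trans *↔× (Fin↔Layer (suc T) ×-↔ Fin↔Code T)

  kernelSize : ℕ → ℕ → ℕ
  kernelSize k zero    = 1
  kernelSize k (suc r) = bitCount (six k) * kernelSize (suc k) r

  Fin↔Kernel : ∀ k r → Fin (kernelSize k r) ↔ Kernel k r
  Fin↔Kernel k zero    = 1↔⊤
  Fin↔Kernel k (suc r) = ↔-trans *↔× (Fin↔Bit (six k) ×-↔ Fin↔Kernel (suc k) r)

  N : ℕ
  N = suc L ! * kernelSize 0 (suc m)

  Fin↔Normal : Fin N ↔ Normal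
  Fin↔Normal = ↔-trans *↔× (Fin↔Code L ×-↔ Fin↔Kernel 0 (suc m))

  kernelSize-product : ∀ k r (q : Fin r → ℕ) → (∀ j → q j ≡ bitCount (six (k + toℕ j)) * 3) →
                       kernelSize k r * 3 ^ r ≡ product (tabulate q)
  kernelSize-product k zero    q q≡ = refl
  kernelSize-product k (suc r) q q≡ = begin
    (bitCount (six k) * kernelSize (suc k) r) * (3 * 3 ^ r)
      ≡⟨ interchange (bitCount (six k)) (kernelSize (suc k) r) 3 (3 ^ r) ⟩
    (bitCount (six k) * 3) * (kernelSize (suc k) r * 3 ^ r)
      ≡⟨ cong₂ _*_ (sym q0≡) (kernelSize-product (suc k) r (q ∘ F.suc) q∘suc≡) ⟩
    q F.zero * product (tabulate (q ∘ F.suc)) ∎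
    where
    open ≡.≡-Reasoning
    q0≡ : q F.zero ≡ bitCount (six k) * 3
    q0≡ = ≡.trans (q≡ F.zero) (cong (λ x → bitCount (six x) * 3) (+-identityʳ k))
    q∘suc≡ : ∀ j → q (F.suc j) ≡ bitCount (six (suc k + toℕ j)) * 3
    q∘suc≡ j = ≡.trans (q≡ (F.suc j)) (cong (λ x → bitCount (six x) * 3) (+-suc k (toℕ j)))

  p≡period : ∀ j → p j ≡ bitCount (six (toℕ j)) * 3
  p≡period j rewrite six-toℕ j with p j | hp j
  ... | .3 | inj₁ refl = refl
  ... | .6 | inj₂ refl = refl

  N-formula : N * 3 ^ suc m ≡ product (tabulate p) * suc L !
  N-formula = begin
    (suc L ! * kernelSize 0 (suc m)) * 3 ^ suc m ≡⟨ *-assoc (suc L !) _ _ ⟩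
    suc L ! * (kernelSize 0 (suc m) * 3 ^ suc m) ≡⟨ cong (suc L ! *_) (kernelSize-product 0 (suc m) p p≡period) ⟩
    suc L ! * product (tabulate p)               ≡⟨ *-comm (suc L !) _ ⟩
    product (tabulate p) * suc L !               ∎
    where open ≡.≡-Reasoning

  -- Orders and the intersection condition

  spin-moves : ∀ j k → spin k 0 1 2 ≢ spin 0 0 1 2 → ¬ adj j ^ʷ k ≈ []
  spin-moves j k moved adjᵏ≈[] = moved (++-cancelʳ ys _ _ (++-cancelˡ xs _ _ fixed))
    where
    t = toℕ j
    xs = replicate t 0
    ys = replicate (m ∸ t) 0
    len : length (xs ++ 0 ∷ 1 ∷ 2 ∷ ys) ≡ suc L
    len = begin
      length (xs ++ 0 ∷ 1 ∷ 2 ∷ ys)  ≡⟨ length-++ xs ⟩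
      length xs + (3 + length ys)    ≡⟨ cong₂ (λ a b → a + (3 + b)) (length-replicate t) (length-replicate (m ∸ t)) ⟩
      t + (3 + (m ∸ t))              ≡⟨ +-comm t _ ⟩
      3 + (m ∸ t) + t                ≡⟨ cong (3 +_) (m∸n+n≡m (≤-pred (toℕ<n j))) ⟩
      suc L                          ∎
      where open ≡.≡-Reasoning
    fixed : xs ++ spin k 0 1 2 ++ ys ≡ xs ++ spin 0 0 1 2 ++ ys
    fixed = ≡.trans (sym (adj-power-spins j xs 0 1 2 ys k (length-replicate t))) (permute-respects adjᵏ≈[] _ len)

  z-nontrivial : ∀ j → six (toℕ j) ≡ true → ¬ z j ≈ []
  z-nontrivial j six-j z≈[] = case ≡.trans (sym flipped) (parity-respects (toℕ j) six-j z≈[] false) of λ ()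
    where
    flipped : parity (toℕ j) false (z j) ≡ true
    flipped = subst (λ i → parity (toℕ j) false (z i) ≡ true) (clamp-toℕ j)
                    (parity-bitWord-self {s = true} false true (≤-pred (toℕ<n j)))

  adj-order : ∀ j → HasOrder p (adj j) (p j)
  adj-order j with p j | hp j | relation⇒≈ (braid j) | six-toℕ j
  ... | .3 | inj₁ refl | adj³≈[] | _     = s≤s z≤n , adj³≈[] , nontrivial
    where
    nontrivial : ∀ i → 1 ≤ i → i < 3 → ¬ adj j ^ʷ i ≈ []
    nontrivial 1 _ _ = spin-moves j 1 (λ ())
    nontrivial 2 _ _ = spin-moves j 2 (λ ())
    nontrivial (suc (suc (suc _))) _ (s≤s (s≤s (s≤s ())))
  ... | .6 | inj₂ refl | adj⁶≈[] | six-j = s≤s z≤n , adj⁶≈[] , nontrivial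
    where
    nontrivial : ∀ i → 1 ≤ i → i < 6 → ¬ adj j ^ʷ i ≈ []
    nontrivial 1 _ _ = spin-moves j 1 (λ ())
    nontrivial 2 _ _ = spin-moves j 2 (λ ())
    nontrivial 3 _ _ = z-nontrivial j six-j
    nontrivial 4 _ _ = spin-moves j 4 (λ ())
    nontrivial 5 _ _ = spin-moves j 5 (λ ())
    nontrivial (suc (suc (suc (suc (suc (suc _)))))) _ (s≤s (s≤s (s≤s (s≤s (s≤s (s≤s ()))))))

  intersection : IntersectionCondition p
  intersection I J w (u , u∈I , w≈u) (u′ , u′∈J , w≈u′) =
    ⟦ x ⟧ , All.zipWith x∈p∩q⁺ (x∈I , x∈J) , ≈-trans w≈u (normalise-correct u)
    where
    x = normalise u
    x≡x′ : x ≡ normalise u′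
    x≡x′ = ⟦⟧-injective _ _ (≈-trans (≈-sym (normalise-correct u))
                              (≈-trans (≈-sym w≈u) (≈-trans w≈u′ (normalise-correct u′))))
    x∈I = normalise-support (_∈ I) u u∈I
    x∈J = subst (λ y → All (_∈ J) ⟦ y ⟧) (sym x≡x′) (normalise-support (_∈ J) u′ u′∈J)

  groupOrder : HasGroupOrder p N
  groupOrder = hasGroupOrder Fin↔Normal ⟦_⟧ (λ w → normalise w , normalise-correct w) ⟦⟧-injective

proposition4p6 : (m : ℕ) → 1 ≤ m → (p : Fin m → ℕ) → (∀ j → p j ≡ 3 ⊎ p j ≡ 6) →
    Σ ℕ λ N → RegularPolytopeGroup p N × (N * 3 ^ m ≡ product (tabulate p) * (suc (suc m) !))
proposition4p6 zero    ()  p hp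
proposition4p6 (suc m) _   p hp = N , (intersection , adj-order , groupOrder) , N-formula
  where open Construction m p hp
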